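{- Let $k\geq 1$ and let $D = \{[\mathbf{x}_1],[\mathbf{x}_2],\dots,[\mathbf{x}_{2k-1}]\}\subseteq V(\widetilde\Omega_{2k})$, where $\mathbf{x}_i$ is the bitstring with a 1 in position $i$ and 0s elsewhere. If $k$ is even, then $D$ is a determining set for the odd component of $\widetilde\Omega_{2k}$. If $k$ is odd, then $D$ is a determining set for $\widetilde\Omega_{2k}$.
   Context: The orthogonality graph $\Omega_{2k}$ has vertex set $\mathbb{Z}_2^{2k}$ (bitstrings of length $2k$), with two vertices adjacent if and only if they differ in exactly $k$ positions. Let $\mathbf{1}$ be the all-ones bitstring and $+$ bitwise addition mod 2. The quotient graph $\widetilde\Omega_{2k}$ has vertices $[\mathbf{u}]=\{\mathbf{u},\mathbf{u}+\mathbf{1}\}$, with $[\mathbf{u}]$ adjacent to $[\mathbf{x}]$ iff $\mathbf{u}$ is adjacent to $\mathbf{x}$ in $\Omega_{2k}$. A vertex $[\mathbf{u}]$ is odd (resp. even) if $\mathbf{u}$ has an odd (resp. even) number of 1s, which does not depend on the representative. When $k$ is even, $\widetilde\Omega_{2k}$ has exactly two connected components, the subgraph induced by the odd vertices (the odd component) and the subgraph induced by the even vertices; when $k$ is odd, $\widetilde\Omega_{2k}$ is connected and bipartite with parts the odd and the even vertices. A set $S$ of vertices of a graph $G$ is a determining set for $G$ if the only automorphism of $G$ fixing every vertex of $S$ is the identity. -}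

module Defs where

open import Data.Bool using (Bool; true; false; not; _xor_)
open import Data.Nat using (ℕ; zero; suc; _+_; _*_; _∸_; _<_; _%_)
open import Data.Vec using (Vec; []; _∷_; map; tabulate)
open import Data.Fin using (Fin; toℕ; _≟_)
open import Data.Product using (Σ; _×_; ∃; proj₁)
open import Data.Sum using (_⊎_)
open import Relation.Nullary using (does)
open import Relation.Binary.PropositionalEquality using (_≡_)

IsEven : ℕ → Set
IsEven n = n % 2 ≡ 0

IsOdd : ℕ → Set
IsOdd n = n % 2 ≡ 1

Bits : ℕ → Set
Bits n = Vec Bool n

weight : ∀ {n} → Bits n → ℕ
weight [] = 0
weight (true ∷ u) = suc (weight u)
weight (false ∷ u) = weight u

_⊕_ : ∀ {n} → Bits n → Bits n → Bits n
[] ⊕ [] = []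
(a ∷ u) ⊕ (b ∷ v) = (a xor b) ∷ (u ⊕ v)

ones : ∀ n → Bits n
ones n = tabulate (λ _ → true)

dist : ∀ {n} → Bits n → Bits n → ℕ
dist u v = weight (u ⊕ v)

-- x_i : 1 in position i, 0 elsewhere (positions indexed from 0 here)
unitVec : ∀ {n} → Fin n → Bits n
unitVec i = tabulate (λ j → does (j ≟ i))

AdjΩ : (k : ℕ) → Bits (2 * k) → Bits (2 * k) → Set
AdjΩ k u v = dist u v ≡ k

-- The quotient Ω̃_{2k} is represented by bitstrings of length 2k together
-- with the equivalence u ~ v  iff  v = u or v = u + 1.
_~_ : ∀ {n} → Bits n → Bits n → Set
u ~ v = (u ≡ v) ⊎ (u ≡ v ⊕ ones _)

-- Graphs whose vertex "set" is a type up to an equivalence relation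
-- (used to represent quotient graphs); Adj respects the equivalence.
record Automorphism {V : Set} (_≈_ : V → V → Set) (Adj : V → V → Set) : Set where
  field
    fun    : V → V
    inv    : V → V
    fun-cong : ∀ {x y} → x ≈ y → fun x ≈ fun y
    inv-cong : ∀ {x y} → x ≈ y → inv x ≈ inv y
    fun-inv : ∀ x → fun (inv x) ≈ x
    inv-fun : ∀ x → inv (fun x) ≈ x
    adj-pres : ∀ x y → Adj x y → Adj (fun x) (fun y)
    adj-refl : ∀ x y → Adj (fun x) (fun y) → Adj x y

IsDeterminingSet : {V : Set} (_≈_ : V → V → Set) (Adj : V → V → Set)
                   (S : V → Set) → Set
IsDeterminingSet {V} _≈_ Adj S =
  (σ : Automorphism _≈_ Adj) →
  (∀ v → S v → Automorphism.fun σ v ≈ v) →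
  ∀ v → Automorphism.fun σ v ≈ v

-- Membership of [u] in D = {[x_1], ..., [x_{2k-1}]}
-- (paper positions 1..2k-1 are Fin indices 0..2k-2)
InD : (k : ℕ) → Bits (2 * k) → Set
InD k u = ∃ λ (i : Fin (2 * k)) → (toℕ i < 2 * k ∸ 1) × (u ~ unitVec i)

QVertex : ℕ → Set
QVertex k = Bits (2 * k)

-- The odd component: odd vertices of Ω̃_{2k}
OddVertex : ℕ → Set
OddVertex k = Σ (Bits (2 * k)) (λ u → IsOdd (weight u))

_~odd_ : ∀ {k} → OddVertex k → OddVertex k → Set
u ~odd v = proj₁ u ~ proj₁ v

AdjOdd : (k : ℕ) → OddVertex k → OddVertex k → Set
AdjOdd k u v = AdjΩ k (proj₁ u) (proj₁ v)

InDOdd : (k : ℕ) → OddVertex k → Set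
InDOdd k u = InD k (proj₁ u)

module Submission where

-- Let σ be an automorphism fixing every vertex of D.  A vertex of weight k ± 1 has a
-- representative u of weight k - 1, and such a u is adjacent to xᵢ exactly when uᵢ = 0;
-- so its neighbours among x₁, …, x₂ₖ₋₁ determine it, and σ fixes it.  An odd vertex [u] is
-- separated from every other vertex [v] by a vertex of weight k ± 1 adjacent to [u] but not
-- to [v], so σ fixes [u] as well; when k is odd, the odd vertices likewise separate the even
-- ones.  The separating vertex is u + z with |z| = k, and the right z is found by prescribing
-- how many of its ones fall into each of the four cells cut out by u and u + v.

open import Defs
open import Data.Bool using (Bool; true; false)
open import Data.Bool.Properties using (xor-assoc; xor-comm; not-involutive)
  renaming (_≟_ to _≟ᵇ_)
open import Data.Nat
  using (ℕ; zero; suc; _+_; _*_; _∸_; _/_; _%_; _≤_; _<_; z≤n; s≤s; z<s; _≟_; _≤?_)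
open import Data.Nat.DivMod using (m≡m%n+[m/n]*n; [m+kn]%n≡m%n)
open import Data.Nat.Properties
open import Data.Nat.Tactic.RingSolver using (solve-∀)
open import Data.Vec using ([]; _∷_; tabulate; lookup)
open import Data.Vec.Properties using (≡-dec)
open import Data.Fin using (Fin; toℕ) renaming (zero to fzero; suc to fsuc)
open import Data.Product using (Σ; _×_; ∃; proj₁; _,_)
open import Data.Sum using (_⊎_; inj₁; inj₂; [_,_]′) renaming (map to ⊎-map)
open import Data.Empty using (⊥-elim)
open import Function using (_∘_; flip; id)
open import Function.Bundles using (_⇔_; mk⇔; Equivalence)
open import Function.Construct.Composition using (_⇔-∘_)
open import Function.Construct.Symmetry using (⇔-sym)
open import Relation.Nullary using (¬_; yes; no; Dec)
open import Relation.Binary.PropositionalEquality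

complement : ∀ {n} → Bits n → Bits n
complement u = u ⊕ ones _

commonOnes : ∀ {n} → Bits n → Bits n → ℕ
commonOnes [] [] = 0
commonOnes (true ∷ u) (true ∷ v) = suc (commonOnes u v)
commonOnes (true ∷ u) (false ∷ v) = commonOnes u v
commonOnes (false ∷ u) (_ ∷ v) = commonOnes u v

⊕-comm : ∀ {n} (u v : Bits n) → u ⊕ v ≡ v ⊕ u
⊕-comm [] [] = refl
⊕-comm (a ∷ u) (b ∷ v) = cong₂ _∷_ (xor-comm a b) (⊕-comm u v)

⊕-assoc : ∀ {n} (u v w : Bits n) → (u ⊕ v) ⊕ w ≡ u ⊕ (v ⊕ w)
⊕-assoc [] [] [] = refl
⊕-assoc (a ∷ u) (b ∷ v) (c ∷ w) = cong₂ _∷_ (xor-assoc a b c) (⊕-assoc u v w)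

⊕-cancelˡ : ∀ {n} (u z : Bits n) → u ⊕ (u ⊕ z) ≡ z
⊕-cancelˡ [] [] = refl
⊕-cancelˡ (true ∷ u) (c ∷ z) = cong₂ _∷_ (not-involutive c) (⊕-cancelˡ u z)
⊕-cancelˡ (false ∷ u) (c ∷ z) = cong (c ∷_) (⊕-cancelˡ u z)

⊕-zerosʳ : ∀ {n} (u : Bits n) → u ⊕ tabulate (λ _ → false) ≡ u
⊕-zerosʳ [] = refl
⊕-zerosʳ (true ∷ u) = cong (true ∷_) (⊕-zerosʳ u)
⊕-zerosʳ (false ∷ u) = cong (false ∷_) (⊕-zerosʳ u)

complement-involutive : ∀ {n} (u : Bits n) → complement (complement u) ≡ u
complement-involutive [] = refl
complement-involutive (true ∷ u) = cong (true ∷_) (complement-involutive u)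
complement-involutive (false ∷ u) = cong (false ∷_) (complement-involutive u)

weight≤length : ∀ {n} (u : Bits n) → weight u ≤ n
weight≤length [] = z≤n
weight≤length (true ∷ u) = s≤s (weight≤length u)
weight≤length (false ∷ u) = m≤n⇒m≤1+n (weight≤length u)

weight-complement : ∀ {n} (u : Bits n) → weight (complement u) + weight u ≡ n
weight-complement [] = refl
weight-complement (true ∷ u) = trans (+-suc _ _) (cong suc (weight-complement u))
weight-complement (false ∷ u) = cong suc (weight-complement u)

dist-comm : ∀ {n} (u v : Bits n) → dist u v ≡ dist v u
dist-comm u v = cong weight (⊕-comm u v)

dist-⊕ : ∀ {n} (u z : Bits n) → dist u (u ⊕ z) ≡ weight z
dist-⊕ u z = cong weight (⊕-cancelˡ u z)

dist-⊕-shift : ∀ {n} (u v z : Bits n) → dist v (u ⊕ z) ≡ dist (u ⊕ v) z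
dist-⊕-shift u v z = cong weight (begin
  v ⊕ (u ⊕ z)  ≡⟨ ⊕-assoc v u z ⟨
  (v ⊕ u) ⊕ z  ≡⟨ cong (_⊕ z) (⊕-comm v u) ⟩
  (u ⊕ v) ⊕ z  ∎)
  where open ≡-Reasoning

dist-complement : ∀ {n} (u v : Bits n) → dist u (complement v) + dist u v ≡ n
dist-complement u v = trans (cong (λ w → weight w + dist u v) (sym (⊕-assoc u v (ones _))))
                            (weight-complement (u ⊕ v))

dist+2*commonOnes : ∀ {n} (u v : Bits n) → dist u v + 2 * commonOnes u v ≡ weight u + weight v
dist+2*commonOnes [] [] = refl
dist+2*commonOnes (true ∷ u) (true ∷ v) = begin
  dist u v + 2 * suc (commonOnes u v)  ≡⟨ shift (dist u v) (commonOnes u v) ⟩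
  2 + (dist u v + 2 * commonOnes u v)  ≡⟨ cong (2 +_) (dist+2*commonOnes u v) ⟩
  2 + (weight u + weight v)            ≡⟨ cong suc (+-suc (weight u) (weight v)) ⟨
  suc (weight u) + suc (weight v)      ∎
  where
  open ≡-Reasoning
  shift : ∀ d o → d + 2 * suc o ≡ 2 + (d + 2 * o)
  shift = solve-∀
dist+2*commonOnes (true ∷ u) (false ∷ v) = cong suc (dist+2*commonOnes u v)
dist+2*commonOnes (false ∷ u) (true ∷ v) =
  trans (cong suc (dist+2*commonOnes u v)) (sym (+-suc (weight u) (weight v)))
dist+2*commonOnes (false ∷ u) (false ∷ v) = dist+2*commonOnes u v

dist≡0⇒≡ : ∀ {n} (u v : Bits n) → dist u v ≡ 0 → u ≡ v
dist≡0⇒≡ [] [] _ = refl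
dist≡0⇒≡ (true ∷ u) (true ∷ v) e = cong (true ∷_) (dist≡0⇒≡ u v e)
dist≡0⇒≡ (false ∷ u) (false ∷ v) e = cong (false ∷_) (dist≡0⇒≡ u v e)

dist≡length⇒≡complement : ∀ {n} (u v : Bits n) → dist u v ≡ n → u ≡ complement v
dist≡length⇒≡complement {n} u v e = dist≡0⇒≡ u (complement v)
  (+-cancelʳ-≡ n _ 0 (trans (cong (dist u (complement v) +_) (sym e)) (dist-complement u v)))

dist-unitVec-false : ∀ {n} (u : Bits n) (i : Fin n) →
  lookup u i ≡ false → dist u (unitVec i) ≡ suc (weight u)
dist-unitVec-false (false ∷ u) fzero _ = cong (suc ∘ weight) (⊕-zerosʳ u)
dist-unitVec-false (true ∷ u) (fsuc i) e = cong suc (dist-unitVec-false u i e)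
dist-unitVec-false (false ∷ u) (fsuc i) e = dist-unitVec-false u i e

dist-unitVec-true : ∀ {n} (u : Bits n) (i : Fin n) →
  lookup u i ≡ true → suc (dist u (unitVec i)) ≡ weight u
dist-unitVec-true (true ∷ u) fzero _ = cong (suc ∘ weight) (⊕-zerosʳ u)
dist-unitVec-true (true ∷ u) (fsuc i) e = cong suc (dist-unitVec-true u i e)
dist-unitVec-true (false ∷ u) (fsuc i) e = dist-unitVec-true u i e

weight-unitVec : ∀ {n} (i : Fin n) → weight (unitVec i) ≡ 1
weight-unitVec {suc n} fzero = cong suc (weight-zeros n)
  where
  weight-zeros : ∀ m → weight (tabulate {n = m} (λ _ → false)) ≡ 0
  weight-zeros zero = refl
  weight-zeros (suc m) = weight-zeros m
weight-unitVec (fsuc i) = weight-unitVec i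

~-sym : ∀ {n} {u v : Bits n} → u ~ v → v ~ u
~-sym (inj₁ e) = inj₁ (sym e)
~-sym {v = v} (inj₂ e) = inj₂ (trans (sym (complement-involutive v)) (cong complement (sym e)))

~-complementʳ : ∀ {n} {u v : Bits n} → u ~ complement v → u ~ v
~-complementʳ (inj₁ e) = inj₂ e
~-complementʳ {v = v} (inj₂ e) = inj₁ (trans e (complement-involutive v))

~-dec : ∀ {n} (u v : Bits n) → Dec (u ~ v)
~-dec u v with ≡-dec _≟ᵇ_ u v | ≡-dec _≟ᵇ_ u (complement v)
... | yes e | _ = yes (inj₁ e)
... | no _ | yes e = yes (inj₂ e)
... | no u≢v | no u≢v̄ = no λ { (inj₁ e) → u≢v e ; (inj₂ e) → u≢v̄ e }

adj-complementʳ : ∀ {k} {x u : Bits (2 * k)} → AdjΩ k x u → AdjΩ k x (complement u)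
adj-complementʳ {k} {x} {u} e = +-cancelʳ-≡ k _ k (begin
  dist x (complement u) + k         ≡⟨ cong (dist x (complement u) +_) e ⟨
  dist x (complement u) + dist x u  ≡⟨ dist-complement x u ⟩
  2 * k                             ≡⟨ cong (k +_) (+-identityʳ k) ⟩
  k + k                             ∎)
  where open ≡-Reasoning

adj-respʳ : ∀ {k} {x u u′ : Bits (2 * k)} → u ~ u′ → AdjΩ k x u → AdjΩ k x u′
adj-respʳ (inj₁ refl) e = e
adj-respʳ {x = x} {u′ = u′} (inj₂ refl) e =
  subst (AdjΩ _ x) (complement-involutive u′) (adj-complementʳ {x = x} {u = complement u′} e)

adj-respˡ : ∀ {k} {u u′ x : Bits (2 * k)} → u ~ u′ → AdjΩ k u x → AdjΩ k u′ x
adj-respˡ {u = u} {u′} {x} u~u′ e =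
  trans (dist-comm u′ x) (adj-respʳ {x = x} u~u′ (trans (dist-comm x u) e))

adj-complementˡ : ∀ {k} {u x : Bits (2 * k)} → AdjΩ k (complement u) x ⇔ AdjΩ k u x
adj-complementˡ {u = u} {x} = mk⇔ (adj-respˡ {u = complement u} {u} {x} (inj₂ refl))
  (adj-respˡ {u = u} {complement u} {x} (~-sym {u = complement u} (inj₂ refl)))

Even Odd : ℕ → Set
Even n = ∃ λ r → n ≡ 2 * r
Odd n = ∃ λ r → n ≡ suc (2 * r)

even-or-odd : ∀ n → Even n ⊎ Odd n
even-or-odd zero = inj₁ (0 , refl)
even-or-odd (suc n) with even-or-odd n
... | inj₁ (r , e) = inj₂ (r , cong suc e)
... | inj₂ (r , e) = inj₁ (suc r , trans (cong suc e) (double-suc r))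
  where
  double-suc : ∀ r → suc (suc (2 * r)) ≡ 2 * suc r
  double-suc = solve-∀

isEven⇒Even : ∀ n → IsEven n → Even n
isEven⇒Even n h = n / 2 , trans (m≡m%n+[m/n]*n n 2) (cong₂ _+_ h (*-comm (n / 2) 2))

isOdd⇒Odd : ∀ n → IsOdd n → Odd n
isOdd⇒Odd n h = n / 2 , trans (m≡m%n+[m/n]*n n 2) (cong₂ _+_ h (*-comm (n / 2) 2))

Odd⇒isOdd : ∀ {n} → Odd n → IsOdd n
Odd⇒isOdd (r , refl) = subst (λ x → suc x % 2 ≡ 1) (*-comm r 2) ([m+kn]%n≡m%n 1 r 2)

half≤odd : ∀ {n m} → n ≡ suc (2 * m) → m ≤ n
half≤odd {m = m} refl = m≤n⇒m≤1+n (m≤m+n m _)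

half≤odd∸2 : ∀ {x y m} → suc x + suc y ≡ suc (2 * m) → m ≤ x + y
half≤odd∸2 {m = zero} e = z≤n
half≤odd∸2 {x} {y} {suc m} e =
  subst (suc m ≤_) x+y≡2m+1 (≤-trans (s≤s (m≤m+n m 0)) (m≤n+m _ m))
  where
  x+y≡2m+1 : m + suc (m + 0) ≡ x + y
  x+y≡2m+1 = suc-injective (suc-injective (trans (sym e) (cong suc (+-suc x y))))

doubles-of-successive-differ : ∀ x c → 2 * x ≢ c ⊎ 2 * suc x ≢ c
doubles-of-successive-differ x c with 2 * x ≟ c
... | no ne = inj₁ ne
... | yes refl = inj₂ (1+n≢n ∘ *-cancelˡ-≡ (suc x) x 2)

-- Cell counts

-- In cells n₀₀ n₀₁ n₁₀ n₁₁, nₐᵦ counts the positions where the first string has bit a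
-- and the second has bit b.
record Cells : Set where
  constructor cells
  field
    n₀₀ n₀₁ n₁₀ n₁₁ : ℕ

size₀ size₁ size₂ size : Cells → ℕ
size₀ (cells a b c d) = a + b
size₁ (cells a b c d) = c + d
size₂ (cells a b c d) = b + d
size g = size₀ g + size₁ g

_≤ᶜ_ : Cells → Cells → Set
cells a b c d ≤ᶜ cells a′ b′ c′ d′ = a ≤ a′ × b ≤ b′ × c ≤ c′ × d ≤ d′

cellsOf : ∀ {n} → Bits n → Bits n → Cells
cellsOf [] [] = cells 0 0 0 0
cellsOf (false ∷ u) (false ∷ v) = let cells a b c d = cellsOf u v in cells (suc a) b c d
cellsOf (false ∷ u) (true ∷ v) = let cells a b c d = cellsOf u v in cells a (suc b) c d
cellsOf (true ∷ u) (false ∷ v) = let cells a b c d = cellsOf u v in cells a b (suc c) d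
cellsOf (true ∷ u) (true ∷ v) = let cells a b c d = cellsOf u v in cells a b c (suc d)

size-cellsOf : ∀ {n} (u v : Bits n) → size (cellsOf u v) ≡ n
size-cellsOf [] [] = refl
size-cellsOf (false ∷ u) (false ∷ v) = cong suc (size-cellsOf u v)
size-cellsOf (false ∷ u) (true ∷ v) with cellsOf u v | size-cellsOf u v
... | cells a b c d | IH = trans (cong (_+ (c + d)) (+-suc a b)) (cong suc IH)
size-cellsOf (true ∷ u) (false ∷ v) with cellsOf u v | size-cellsOf u v
... | cells a b c d | IH = trans (+-suc (a + b) (c + d)) (cong suc IH)
size-cellsOf (true ∷ u) (true ∷ v) with cellsOf u v | size-cellsOf u v
... | cells a b c d | IH =
  trans (cong (a + b +_) (+-suc c d)) (trans (+-suc (a + b) (c + d)) (cong suc IH))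

size₁-cellsOf : ∀ {n} (u v : Bits n) → size₁ (cellsOf u v) ≡ weight u
size₁-cellsOf [] [] = refl
size₁-cellsOf (false ∷ u) (false ∷ v) = size₁-cellsOf u v
size₁-cellsOf (false ∷ u) (true ∷ v) = size₁-cellsOf u v
size₁-cellsOf (true ∷ u) (false ∷ v) = cong suc (size₁-cellsOf u v)
size₁-cellsOf (true ∷ u) (true ∷ v) = trans (+-suc _ _) (cong suc (size₁-cellsOf u v))

size₂-cellsOf : ∀ {n} (u v : Bits n) → size₂ (cellsOf u v) ≡ weight v
size₂-cellsOf [] [] = refl
size₂-cellsOf (false ∷ u) (false ∷ v) = size₂-cellsOf u v
size₂-cellsOf (false ∷ u) (true ∷ v) = cong suc (size₂-cellsOf u v)
size₂-cellsOf (true ∷ u) (false ∷ v) = size₂-cellsOf u v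
size₂-cellsOf (true ∷ u) (true ∷ v) = trans (+-suc _ _) (cong suc (size₂-cellsOf u v))

realise : ∀ {n} (u v : Bits n) (g : Cells) → g ≤ᶜ cellsOf u v →
  Σ (Bits n) λ z → weight z ≡ size g × commonOnes u z ≡ size₁ g × commonOnes v z ≡ size₂ g
realise [] [] (cells 0 0 0 0) (z≤n , z≤n , z≤n , z≤n) = [] , refl , refl , refl
realise (false ∷ u) (false ∷ v) (cells 0 b c d) (_ , le) =
  let z , w , o₁ , o₂ = realise u v (cells 0 b c d) (z≤n , le)
  in false ∷ z , w , o₁ , o₂
realise (false ∷ u) (false ∷ v) (cells (suc a) b c d) (s≤s l₀ , le) =
  let z , w , o₁ , o₂ = realise u v (cells a b c d) (l₀ , le)
  in true ∷ z , cong suc w , o₁ , o₂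
realise (false ∷ u) (true ∷ v) (cells a 0 c d) (l₀ , _ , le) =
  let z , w , o₁ , o₂ = realise u v (cells a 0 c d) (l₀ , z≤n , le)
  in false ∷ z , w , o₁ , o₂
realise (false ∷ u) (true ∷ v) (cells a (suc b) c d) (l₀ , s≤s l₁ , le) =
  let z , w , o₁ , o₂ = realise u v (cells a b c d) (l₀ , l₁ , le)
  in true ∷ z , trans (cong suc w) (cong (_+ (c + d)) (sym (+-suc a b))) , o₁ , cong suc o₂
realise (true ∷ u) (false ∷ v) (cells a b 0 d) (l₀ , l₁ , _ , l₃) =
  let z , w , o₁ , o₂ = realise u v (cells a b 0 d) (l₀ , l₁ , z≤n , l₃)
  in false ∷ z , w , o₁ , o₂
realise (true ∷ u) (false ∷ v) (cells a b (suc c) d) (l₀ , l₁ , s≤s l₂ , l₃) =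
  let z , w , o₁ , o₂ = realise u v (cells a b c d) (l₀ , l₁ , l₂ , l₃)
  in true ∷ z , trans (cong suc w) (sym (+-suc (a + b) (c + d))) , cong suc o₁ , o₂
realise (true ∷ u) (true ∷ v) (cells a b c 0) (l₀ , l₁ , l₂ , _) =
  let z , w , o₁ , o₂ = realise u v (cells a b c 0) (l₀ , l₁ , l₂ , z≤n)
  in false ∷ z , w , o₁ , o₂
realise (true ∷ u) (true ∷ v) (cells a b c (suc d)) (l₀ , l₁ , l₂ , s≤s l₃) =
  let z , w , o₁ , o₂ = realise u v (cells a b c d) (l₀ , l₁ , l₂ , l₃)
  in true ∷ z , trans (cong suc w) (sym (shift (a + b) c d))
   , trans (cong suc o₁) (sym (+-suc c d)) , trans (cong suc o₂) (sym (+-suc b d))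
  where
  shift : ∀ p c d → p + (c + suc d) ≡ suc (p + (c + d))
  shift = solve-∀

split : ∀ {a b s} → s ≤ a + b → ∃ λ x → ∃ λ y → x ≤ a × y ≤ b × x + y ≡ s
split {zero} {s = s} le = 0 , s , z≤n , le , refl
split {suc a} {s = zero} _ = 0 , 0 , z≤n , z≤n , refl
split {suc a} {s = suc s} (s≤s le) =
  let x , y , x≤a , y≤b , x+y≡s = split le in suc x , y , s≤s x≤a , y≤b , cong suc x+y≡s

-- With c the cell counts of (u , u + v), |u| = 2m + 1 and k = t + m + 1, such a g is realised
-- by a z for which u + z has weight k ± 1, is adjacent to u and not to v.
SeparatingSelection : ℕ → ℕ → Cells → Set
SeparatingSelection m t c = ∃ λ g → g ≤ᶜ c × size g ≡ t + suc m
  × (size₁ g ≡ suc m ⊎ size₁ g ≡ m) × 2 * size₂ g ≢ size₂ c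

-- The (m + 1)-st one of z may go into either cell; the two choices differ by one in the overlap
-- with the second string, so at most one of them halves it.
separatingSelection-mixed₁ : ∀ {m t} a b c d →
  a + b ≡ suc (2 * t) → suc c + suc d ≡ suc (2 * m) →
  SeparatingSelection m t (cells a b (suc c) (suc d))
separatingSelection-mixed₁ {m} {t} a b c d e₀ e₁
  with split {a} {b} {t} (half≤odd e₀) | split {c} {d} {m} (half≤odd∸2 e₁)
... | p , q , p≤a , q≤b , p+q≡t | x , y , x≤c , y≤d , x+y≡m
  with doubles-of-successive-differ (q + y) (b + suc d)
... | inj₁ ≢half = cells p q (suc x) y , (p≤a , q≤b , s≤s x≤c , m≤n⇒m≤1+n y≤d)
  , cong₂ _+_ p+q≡t (cong suc x+y≡m) , inj₁ (cong suc x+y≡m) , ≢half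
... | inj₂ ≢half = cells p q x (suc y) , (p≤a , q≤b , m≤n⇒m≤1+n x≤c , s≤s y≤d)
  , cong₂ _+_ p+q≡t x+suc-y≡suc-m , inj₁ x+suc-y≡suc-m
  , ≢half ∘ subst (λ s → 2 * s ≡ b + suc d) (+-suc q y)
  where
  x+suc-y≡suc-m : x + suc y ≡ suc m
  x+suc-y≡suc-m = trans (+-suc x y) (cong suc x+y≡m)

separatingSelection-mixed₀ : ∀ {m t} a b c d →
  suc a + suc b ≡ suc (2 * t) → c + d ≡ suc (2 * m) →
  SeparatingSelection m t (cells (suc a) (suc b) c d)
separatingSelection-mixed₀ {m} {t} a b c d e₀ e₁
  with split {a} {b} {t} (half≤odd∸2 e₀) | split {c} {d} {m} (half≤odd e₁)
... | p , q , p≤a , q≤b , p+q≡t | x , y , x≤c , y≤d , x+y≡m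
  with doubles-of-successive-differ (q + y) (suc b + d)
... | inj₁ ≢half = cells (suc p) q x y , (s≤s p≤a , m≤n⇒m≤1+n q≤b , x≤c , y≤d)
  , trans (cong₂ _+_ (cong suc p+q≡t) x+y≡m) (sym (+-suc t m)) , inj₂ x+y≡m , ≢half
... | inj₂ ≢half = cells p (suc q) x y , (m≤n⇒m≤1+n p≤a , s≤s q≤b , x≤c , y≤d)
  , trans (cong₂ _+_ (trans (+-suc p q) (cong suc p+q≡t)) x+y≡m) (sym (+-suc t m))
  , inj₂ x+y≡m , ≢half

-- Otherwise the zeros and the ones of the first string each lie in a single cell, in different
-- columns as the second string is neither 0 nor 1, and parity rules out halving.
separatingSelection : ∀ m t (c : Cells) →
  size₀ c ≡ suc (2 * t) → size₁ c ≡ suc (2 * m) → size₂ c ≢ 0 → size₂ c ≢ size c →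
  SeparatingSelection m t c
separatingSelection m t (cells a b (suc c) (suc d)) e₀ e₁ _ _ =
  separatingSelection-mixed₁ a b c d e₀ e₁
separatingSelection m t (cells (suc a) (suc b) c d) e₀ e₁ _ _ =
  separatingSelection-mixed₀ a b c d e₀ e₁
separatingSelection m t (cells 0 b 0 d) _ _ _ ≢size = ⊥-elim (≢size refl)
separatingSelection m t (cells a 0 c 0) _ _ ≢0 _ = ⊥-elim (≢0 refl)
separatingSelection m t (cells a 0 0 d) e₀ e₁ _ _ = cells t 0 0 (suc m)
  , (half≤odd (trans (sym (+-identityʳ a)) e₀) , z≤n , z≤n
    , subst (suc m ≤_) (sym e₁) (s≤s (m≤m+n m _)))
  , cong (_+ suc m) (+-identityʳ t) , inj₁ refl
  , λ e → even≢odd (suc m) m (trans e e₁)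
separatingSelection m t (cells 0 b c 0) e₀ e₁ _ _ = cells 0 t (suc m) 0
  , (z≤n , half≤odd e₀ , subst (suc m ≤_) (sym (trans (sym (+-identityʳ c)) e₁)) (s≤s (m≤m+n m _))
    , z≤n)
  , cong (t +_) (+-identityʳ (suc m)) , inj₁ (+-identityʳ (suc m))
  , λ e → even≢odd t t
      (trans (cong (2 *_) (sym (+-identityʳ t))) (trans e (trans (+-identityʳ b) e₀)))

nonHalving-selection : ∀ k (c : Cells) → size c ≡ 2 * k → size₂ c ≢ 0 → size₂ c ≢ 2 * k →
  ∃ λ g → g ≤ᶜ c × size g ≡ k × 2 * size₂ g ≢ size₂ c
nonHalving-selection k (cells a b c d) e ≢0 ≢full with b + d ≤? k
... | yes few = let x , y , x≤a , y≤c , x+y≡k = split {a} {c} {k} k≤a+c in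
  cells x 0 y 0 , (x≤a , z≤n , y≤c , z≤n)
  , trans (cong₂ _+_ (+-identityʳ x) (+-identityʳ y)) x+y≡k , ≢0 ∘ sym
  where
  k≤a+c : k ≤ a + c
  k≤a+c = +-cancelʳ-≤ (b + d) k (a + c) (begin
    k + (b + d)      ≤⟨ +-monoʳ-≤ k few ⟩
    k + k            ≡⟨ cong (k +_) (+-identityʳ k) ⟨
    2 * k            ≡⟨ e ⟨
    a + b + (c + d)  ≡⟨ regroup a b c d ⟨
    a + c + (b + d)  ∎)
    where
    open ≤-Reasoning
    regroup : ∀ a b c d → (a + c) + (b + d) ≡ (a + b) + (c + d)
    regroup = solve-∀
... | no many = let x , y , x≤b , y≤d , x+y≡k = split {b} {d} {k} (<⇒≤ (≰⇒> many)) in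
  cells 0 x 0 y , (z≤n , x≤b , z≤n , y≤d) , x+y≡k
  , ≢full ∘ sym ∘ trans (cong (2 *_) (sym x+y≡k))

-- Separating vertices

NearK : ∀ {n} → ℕ → Bits n → Set
NearK k y = suc (weight y) ≡ k ⊎ weight y ≡ suc k

dist-⊕≢ : ∀ {n k} (u v z : Bits n) → weight z ≡ k →
  2 * commonOnes (u ⊕ v) z ≢ dist u v → dist v (u ⊕ z) ≢ k
dist-⊕≢ {k = k} u v z wz ≢half e = ≢half (+-cancelˡ-≡ k _ _ (begin
  k + 2 * commonOnes (u ⊕ v) z               ≡⟨ cong (_+ _) (trans (sym e) (dist-⊕-shift u v z)) ⟩
  dist (u ⊕ v) z + 2 * commonOnes (u ⊕ v) z  ≡⟨ dist+2*commonOnes (u ⊕ v) z ⟩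
  dist u v + weight z                        ≡⟨ +-comm (dist u v) (weight z) ⟩
  weight z + dist u v                        ≡⟨ cong (_+ dist u v) wz ⟩
  k + dist u v                               ∎))
  where open ≡-Reasoning

nearK-⊕ : ∀ {n k m} (u z : Bits n) → weight u ≡ suc (2 * m) → weight z ≡ k →
  commonOnes u z ≡ suc m ⊎ commonOnes u z ≡ m → NearK k (u ⊕ z)
nearK-⊕ {k = k} {m} u z wu wz (inj₁ o) = inj₁ (+-cancelʳ-≡ (suc (2 * m)) _ _ (begin
  suc (dist u z) + suc (2 * m)   ≡⟨ rearrange (dist u z) m ⟩
  dist u z + 2 * suc m           ≡⟨ cong (λ o → dist u z + 2 * o) o ⟨
  dist u z + 2 * commonOnes u z  ≡⟨ dist+2*commonOnes u z ⟩
  weight u + weight z            ≡⟨ cong₂ _+_ wu wz ⟩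
  suc (2 * m) + k                ≡⟨ +-comm (suc (2 * m)) k ⟩
  k + suc (2 * m)                ∎))
  where
  open ≡-Reasoning
  rearrange : ∀ d m → suc d + suc (2 * m) ≡ d + 2 * suc m
  rearrange = solve-∀
nearK-⊕ {k = k} {m} u z wu wz (inj₂ o) = inj₂ (+-cancelʳ-≡ (2 * m) _ _ (begin
  dist u z + 2 * m               ≡⟨ cong (λ o → dist u z + 2 * o) o ⟨
  dist u z + 2 * commonOnes u z  ≡⟨ dist+2*commonOnes u z ⟩
  weight u + weight z            ≡⟨ cong₂ _+_ wu wz ⟩
  suc (2 * m) + k                ≡⟨ cong suc (+-comm (2 * m) k) ⟩
  suc k + 2 * m                  ∎))
  where open ≡-Reasoning

odd-⊕ : ∀ {n k} (u z : Bits n) → Odd k → Even (weight u) → weight z ≡ k → Odd (weight (u ⊕ z))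
odd-⊕ u z (j , refl) (m , wu) wz with even-or-odd (weight (u ⊕ z))
... | inj₂ odd = odd
... | inj₁ (r , wy) = ⊥-elim (even≢odd (r + commonOnes u z) (m + j) (begin
  2 * (r + commonOnes u z)       ≡⟨ *-distribˡ-+ 2 r (commonOnes u z) ⟩
  2 * r + 2 * commonOnes u z     ≡⟨ cong (_+ 2 * commonOnes u z) wy ⟨
  dist u z + 2 * commonOnes u z  ≡⟨ dist+2*commonOnes u z ⟩
  weight u + weight z            ≡⟨ cong₂ _+_ wu wz ⟩
  2 * m + suc (2 * j)            ≡⟨ rearrange m j ⟩
  suc (2 * (m + j))              ∎))
  where
  open ≡-Reasoning
  rearrange : ∀ m j → 2 * m + suc (2 * j) ≡ suc (2 * (m + j))
  rearrange = solve-∀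

≁⇒size₂-cellsOf≢0 : ∀ {n} {u v : Bits n} → ¬ (v ~ u) → size₂ (cellsOf u (u ⊕ v)) ≢ 0
≁⇒size₂-cellsOf≢0 {u = u} {v} v≁u e =
  v≁u (inj₁ (sym (dist≡0⇒≡ u v (trans (sym (size₂-cellsOf u (u ⊕ v))) e))))

≁⇒size₂-cellsOf≢length : ∀ {n} {u v : Bits n} → ¬ (v ~ u) → size₂ (cellsOf u (u ⊕ v)) ≢ n
≁⇒size₂-cellsOf≢length {u = u} {v} v≁u e =
  v≁u (~-sym (inj₂ (dist≡length⇒≡complement u v
    (trans (sym (size₂-cellsOf u (u ⊕ v))) e))))

realise-separating : ∀ {k} (u v : Bits (2 * k)) (g : Cells) → g ≤ᶜ cellsOf u (u ⊕ v) →
  size g ≡ k → 2 * size₂ g ≢ size₂ (cellsOf u (u ⊕ v)) →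
  ∃ λ z → weight z ≡ k × commonOnes u z ≡ size₁ g × AdjΩ k u (u ⊕ z) × ¬ AdjΩ k v (u ⊕ z)
realise-separating u v g g≤c size-g ≢half =
  let z , wz , o₁ , o₂ = realise u (u ⊕ v) g g≤c
      weight-z = trans wz size-g
      halving⇒ : 2 * commonOnes (u ⊕ v) z ≡ dist u v →
                 2 * size₂ g ≡ size₂ (cellsOf u (u ⊕ v))
      halving⇒ e = trans (cong (2 *_) (sym o₂)) (trans e (sym (size₂-cellsOf u (u ⊕ v))))
  in z , weight-z , o₁ , trans (dist-⊕ u z) weight-z
   , dist-⊕≢ u v z weight-z (≢half ∘ halving⇒)

odd-separated-by-nearK : ∀ k m (u v : Bits (2 * k)) → weight u ≡ suc (2 * m) → ¬ (v ~ u) →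
  ∃ λ y → NearK k y × AdjΩ k u y × ¬ AdjΩ k v y
odd-separated-by-nearK k m u v wu v≁u =
  let g , g≤c , size-g , size₁-g , ≢half = separatingSelection m t c size₀-c size₁-c
        (≁⇒size₂-cellsOf≢0 v≁u)
        (≁⇒size₂-cellsOf≢length v≁u ∘ flip trans (size-cellsOf u (u ⊕ v)))
      z , wz , o₁ , adj-u , ¬adj-v = realise-separating u v g g≤c (trans size-g t+suc-m≡k) ≢half
  in u ⊕ z , nearK-⊕ u z wu wz (⊎-map (trans o₁) (trans o₁) size₁-g) , adj-u , ¬adj-v
  where
  c = cellsOf u (u ⊕ v)
  t = k ∸ suc m
  t+suc-m≡k : t + suc m ≡ k
  t+suc-m≡k = m∸n+n≡m (*-cancelˡ-< 2 m k (subst (_≤ 2 * k) wu (weight≤length u)))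
  size₁-c : size₁ c ≡ suc (2 * m)
  size₁-c = trans (size₁-cellsOf u (u ⊕ v)) wu
  size₀-c : size₀ c ≡ suc (2 * t)
  size₀-c = +-cancelʳ-≡ (suc (2 * m)) _ _ (begin
    size₀ c + suc (2 * m)      ≡⟨ cong (size₀ c +_) size₁-c ⟨
    size c                     ≡⟨ size-cellsOf u (u ⊕ v) ⟩
    2 * k                      ≡⟨ cong (2 *_) t+suc-m≡k ⟨
    2 * (t + suc m)            ≡⟨ rearrange t m ⟩
    suc (2 * t) + suc (2 * m)  ∎)
    where
    open ≡-Reasoning
    rearrange : ∀ t m → 2 * (t + suc m) ≡ suc (2 * t) + suc (2 * m)
    rearrange = solve-∀

-- When k is odd, u + z has odd weight whatever its overlap with u, so only non-adjacency to v
-- has to be arranged.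
even-separated-by-odd : ∀ k (u v : Bits (2 * k)) → Odd k → Even (weight u) → ¬ (v ~ u) →
  ∃ λ y → Odd (weight y) × AdjΩ k u y × ¬ AdjΩ k v y
even-separated-by-odd k u v odd-k even-u v≁u =
  let g , g≤c , size-g , ≢half =
        nonHalving-selection k (cellsOf u (u ⊕ v)) (size-cellsOf u (u ⊕ v))
        (≁⇒size₂-cellsOf≢0 v≁u) (≁⇒size₂-cellsOf≢length v≁u)
      z , wz , _ , adj-u , ¬adj-v = realise-separating u v g g≤c size-g ≢half
  in u ⊕ z , odd-⊕ u z odd-k even-u wz , adj-u , ¬adj-v

-- Neighbours in D

zero-below : ∀ {n} (u : Bits (suc n)) → weight u < n → ∃ λ i → toℕ i < n × lookup u i ≡ false
zero-below {suc n} (false ∷ u) _ = fzero , s≤s z≤n , refl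
zero-below {suc n} (true ∷ u) (s≤s lt) =
  let i , i<n , ui = zero-below u lt in fsuc i , s≤s i<n , ui

≡-from-prefix-weight : ∀ {n} (u v : Bits (suc n)) →
  (∀ i → toℕ i < n → lookup u i ≡ lookup v i) → weight u ≡ weight v → u ≡ v
≡-from-prefix-weight {zero} (true ∷ []) (true ∷ []) _ _ = refl
≡-from-prefix-weight {zero} (false ∷ []) (false ∷ []) _ _ = refl
≡-from-prefix-weight {suc n} (a ∷ u) (b ∷ v) agree wu≡wv with agree fzero (s≤s z≤n)
... | refl = cong (a ∷_)
  (≡-from-prefix-weight u v (λ i lt → agree (fsuc i) (s≤s lt)) (tail-weight a wu≡wv))
  where
  tail-weight : ∀ a → weight (a ∷ u) ≡ weight (a ∷ v) → weight u ≡ weight v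
  tail-weight true = suc-injective
  tail-weight false e = e

≡-from-false⇔ : ∀ {a b : Bool} → a ≡ false ⇔ b ≡ false → a ≡ b
≡-from-false⇔ {false} {false} _ = refl
≡-from-false⇔ {true} {true} _ = refl
≡-from-false⇔ {false} {true} eq = sym (Equivalence.to eq refl)
≡-from-false⇔ {true} {false} eq = Equivalence.from eq refl

dist-unitVec-low : ∀ {n k} (u : Bits n) (i : Fin n) → suc (weight u) ≡ k →
  dist u (unitVec i) ≡ k ⇔ lookup u i ≡ false
dist-unitVec-low u i wu = mk⇔ to (λ ui → trans (dist-unitVec-false u i ui) wu)
  where
  to : dist u (unitVec i) ≡ _ → lookup u i ≡ false
  to e with lookup u i in ui
  ... | false = refl
  ... | true = ⊥-elim (m≢1+n+m (weight u) {1}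
    (sym (trans (cong suc (trans wu (sym e))) (dist-unitVec-true u i ui))))

dist-unitVec⇒nearK : ∀ {n k} (v : Bits n) (i : Fin n) → dist v (unitVec i) ≡ k → NearK k v
dist-unitVec⇒nearK v i e with lookup v i in vi
... | false = inj₁ (trans (sym (dist-unitVec-false v i vi)) e)
... | true = inj₂ (trans (sym (dist-unitVec-true v i vi)) (cong suc e))

complement-of-high : ∀ {k} (v : Bits (2 * k)) →
  weight v ≡ suc k → suc (weight (complement v)) ≡ k
complement-of-high {k} v wv = +-cancelʳ-≡ (suc k) _ _ (begin
  suc (weight (complement v) + suc k)     ≡⟨ cong (suc ∘ (weight (complement v) +_)) wv ⟨
  suc (weight (complement v) + weight v)  ≡⟨ cong suc (weight-complement v) ⟩
  suc (2 * k)                             ≡⟨ rearrange k ⟩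
  k + suc k                               ∎)
  where
  open ≡-Reasoning
  rearrange : ∀ k → suc (2 * k) ≡ k + suc k
  rearrange = solve-∀

nearK⇒odd : ∀ {n k} (y : Bits n) → Even k → NearK k y → Odd (weight y)
nearK⇒odd y (zero , refl) (inj₁ ())
nearK⇒odd y (suc j , refl) (inj₁ wy) = j , trans (suc-injective wy) (+-suc j (j + 0))
nearK⇒odd y (j , refl) (inj₂ wy) = j , wy

SameNeighboursInD : (k : ℕ) → Bits (2 * k) → Bits (2 * k) → Set
SameNeighboursInD k u v =
  ∀ i → toℕ i < 2 * k ∸ 1 → AdjΩ k u (unitVec i) ⇔ AdjΩ k v (unitVec i)

sameNeighbours-complementˡ : ∀ {k} (u v : Bits (2 * k)) →
  SameNeighboursInD k u v → SameNeighboursInD k (complement u) v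
sameNeighbours-complementˡ u v same i lt = same i lt ⇔-∘ adj-complementˡ {u = u} {unitVec i}

sameNeighbours-complementʳ : ∀ {k} (u v : Bits (2 * k)) →
  SameNeighboursInD k u v → SameNeighboursInD k u (complement v)
sameNeighbours-complementʳ u v same i lt =
  ⇔-sym (adj-complementˡ {u = v} {unitVec i}) ⇔-∘ same i lt

sameNeighbours-low⇒≡ : ∀ {k} (u v : Bits (2 * k)) → suc (weight u) ≡ k → suc (weight v) ≡ k →
  SameNeighboursInD k u v → u ≡ v
sameNeighbours-low⇒≡ {suc k} u v wu wv same =
  ≡-from-prefix-weight u v agree (suc-injective (trans wu (sym wv)))
  where
  agree : ∀ i → toℕ i < 2 * suc k ∸ 1 → lookup u i ≡ lookup v i
  agree i lt = ≡-from-false⇔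
    (dist-unitVec-low v i wv ⇔-∘ (same i lt ⇔-∘ ⇔-sym (dist-unitVec-low u i wu)))

-- As |u| = k - 1 < 2k - 1, u has a zero in some position i < 2k - 1; v is then adjacent to xᵢ,
-- which puts v or its complement at weight k - 1 too.
sameNeighbours-low⇒~ : ∀ {k} (u v : Bits (2 * k)) → suc (weight u) ≡ k →
  SameNeighboursInD k u v → v ~ u
sameNeighbours-low⇒~ {suc k} u v wu same
  with zero-below u (subst (_< _) (sym (suc-injective wu)) (m<m+n k z<s))
... | i , lt , ui
  with dist-unitVec⇒nearK v i
         (Equivalence.to (same i lt) (Equivalence.from (dist-unitVec-low u i wu) ui))
... | inj₁ wv = inj₁ (sym (sameNeighbours-low⇒≡ u v wu wv same))
... | inj₂ wv = ~-sym (inj₂ (sameNeighbours-low⇒≡ u (complement v) wu (complement-of-high v wv)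
  (sameNeighbours-complementʳ u v same)))

sameNeighbours-nearK⇒~ : ∀ {k} (u v : Bits (2 * k)) → NearK k u → SameNeighboursInD k u v → v ~ u
sameNeighbours-nearK⇒~ u v (inj₁ wu) same = sameNeighbours-low⇒~ u v wu same
sameNeighbours-nearK⇒~ u v (inj₂ wu) same = ~-complementʳ
  (sameNeighbours-low⇒~ (complement u) v (complement-of-high u wu)
    (sameNeighbours-complementˡ u v same))

-- Automorphisms fixing D

-- V is the vertex type of a subgraph of Ω̃₂ₖ, embedded by ι, containing all odd vertices and all
-- vertices of weight k ± 1.
module Rigidity (k : ℕ) {V : Set} (ι : V → Bits (2 * k))
  (lift-odd : ∀ y → Odd (weight y) → ∃ λ a → ι a ≡ y)
  (lift-nearK : ∀ y → NearK k y → ∃ λ a → ι a ≡ y)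
  (σ : Automorphism (λ a b → ι a ~ ι b) (λ a b → AdjΩ k (ι a) (ι b)))
  (fixes-D : ∀ a → InD k (ι a) → ι (Automorphism.fun σ a) ~ ι a)
  where

  open Automorphism σ

  Fixed : V → Set
  Fixed a = ι (fun a) ~ ι a

  FixedImage : Bits (2 * k) → Set
  FixedImage y = ∃ λ b → ι b ≡ y × Fixed b

  fixedImage : {P : Bits (2 * k) → Set} → (∀ y → P y → ∃ λ b → ι b ≡ y) →
    (∀ b → P (ι b) → Fixed b) → ∀ y → P y → FixedImage y
  fixedImage lift fixes y py with lift y py
  ... | b , refl = b , refl , fixes b py

  adj-fixedImage : ∀ a {y} → FixedImage y → AdjΩ k (ι a) y ⇔ AdjΩ k (ι (fun a)) y
  adj-fixedImage a (b , refl , fb) = mk⇔ (adj-respʳ {x = ι (fun a)} fb ∘ adj-pres a b)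
                                         (adj-refl a b ∘ adj-respʳ {x = ι (fun a)} (~-sym fb))

  unitVec-fixed : ∀ i → toℕ i < 2 * k ∸ 1 → FixedImage (unitVec i)
  unitVec-fixed i lt with lift-odd (unitVec i) (0 , weight-unitVec i)
  ... | b , ιb≡xᵢ = b , ιb≡xᵢ , fixes-D b (i , lt , inj₁ ιb≡xᵢ)

  fixes-nearK : ∀ a → NearK k (ι a) → Fixed a
  fixes-nearK a near =
    sameNeighbours-nearK⇒~ (ι a) (ι (fun a)) near (λ i lt → adj-fixedImage a (unitVec-fixed i lt))

  fixed-if-separated : {P : Bits (2 * k) → Set} → (∀ y → P y → FixedImage y) → ∀ a →
    (∀ v → ¬ (v ~ ι a) → ∃ λ y → P y × AdjΩ k (ι a) y × ¬ AdjΩ k v y) → Fixed a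
  fixed-if-separated fixedP a separated with ~-dec (ι (fun a)) (ι a)
  ... | yes fixed = fixed
  ... | no moved = let y , py , adj , ¬adj = separated (ι (fun a)) moved in
    ⊥-elim (¬adj (Equivalence.to (adj-fixedImage a (fixedP y py)) adj))

  fixes-odd : ∀ a → Odd (weight (ι a)) → Fixed a
  fixes-odd a (m , wa) = fixed-if-separated (fixedImage lift-nearK fixes-nearK) a
    (λ v → odd-separated-by-nearK k m (ι a) v wa)

  fixes-even : Odd k → ∀ a → Even (weight (ι a)) → Fixed a
  fixes-even odd-k a even = fixed-if-separated (fixedImage lift-odd fixes-odd) a
    (λ v → even-separated-by-odd k (ι a) v odd-k even)

odd-component-determined : ∀ k → Even k → IsDeterminingSet (_~odd_ {k}) (AdjOdd k) (InDOdd k)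
odd-component-determined k even-k σ fixes-D (u , odd-u) = fixes-odd (u , odd-u) (isOdd⇒Odd _ odd-u)
  where
  open Rigidity k proj₁ (λ y odd → (y , Odd⇒isOdd odd) , refl)
    (λ y near → (y , Odd⇒isOdd (nearK⇒odd y even-k near)) , refl) σ fixes-D

whole-determined : ∀ k → Odd k → IsDeterminingSet (_~_ {2 * k}) (AdjΩ k) (InD k)
whole-determined k odd-k σ fixes-D u =
  [ fixes-even odd-k u , fixes-odd u ]′ (even-or-odd (weight u))
  where open Rigidity k id (λ y _ → y , refl) (λ y _ → y , refl) σ fixes-D

proposition3 : (k : ℕ) → 1 ≤ k →
    (IsEven k → IsDeterminingSet (_~odd_ {k}) (AdjOdd k) (InDOdd k)) ×
    (IsOdd k → IsDeterminingSet (_~_ {2 * k}) (AdjΩ k) (InD k))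
proposition3 k _ = odd-component-determined k ∘ isEven⇒Even k , whole-determined k ∘ isOdd⇒Odd k
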